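{- Consider the algorithm Greedy Dual run on an instance of MPMD or MBPMD. At any time, for any set $S$ that is currently active or inactive, the set of marked edges with both endpoints in $S$ forms a spanning tree on the requests of $S$.
   Context: Problem. Let $(\mathcal{X},\mathrm{dist})$ be a metric space. Requests arrive online over time. Each request $u$ has a position $\mathrm{pos}(u)\in\mathcal{X}$, an arrival time $\mathrm{atime}(u)$ and a sign $\mathrm{sgn}(u)$: $\mathrm{sgn}(u)=0$ for all requests in the non-bipartite variant MPMD; in the bipartite variant MBPMD half the requests have sign $+1$ and half have sign $-1$. An algorithm may at any time match two arrived, still unmatched requests $u,v$ with $\mathrm{sgn}(u)=-\mathrm{sgn}(v)$. Notation. For a set $V$ of requests, $E$ is the set of pairs $\{u,v\}$ of distinct requests of $V$ with $\mathrm{sgn}(u)=-\mathrm{sgn}(v)$. For $S\subseteq V$, $\delta(S)$ is the set of edges of $E$ with exactly one endpoint in $S$. For an edge $e=\{u,v\}$, $\mathrm{optcost}(e)=\mathrm{dist}(\mathrm{pos}(u),\mathrm{pos}(v))+|\mathrm{atime}(u)-\mathrm{atime}(v)|$. Algorithm Greedy Dual (GD). It keeps a variable $y_S$ for every set $S$ of arrived requests. It also keeps a partition of the arrived requests into active sets, with $\mathcal{A}(u)$ the active set containing $u$. A set is inactive if it was active earlier but is no longer active. - When a request $u$ arrives, $\{u\}$ becomes a new active set, and $y_S$ is initialized to $0$ for every set $S$ containing $u$. - While there is an edge $e=\{u,v\}\in E$ of arrived requests with $\mathcal{A}(u)\ne\mathcal{A}(v)$ and $\sum_{S:\,e\in\delta(S)}y_S=\mathrm{optcost}(e)$,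 GD does the following. It replaces $\mathcal{A}(u)$ and $\mathcal{A}(v)$ by their union $S$ as an active set; the two old sets become inactive. It marks $e$. Then, while $S$ contains two free (unmatched) requests $u',v'$ with $\mathrm{sgn}(u')=-\mathrm{sgn}(v')$, it matches them immediately. - When neither event occurs, every active set containing at least one free request (a growing set) has its $y_S$ increased continuously at rate $1$ with time. Other variables stay unchanged. -}

module Defs where

open import Level using (0ℓ)
open import Data.Nat using (ℕ; zero; suc)
open import Data.Bool using (Bool; true; false; _xor_; if_then_else_)
open import Data.Fin using (Fin)
open import Data.Fin.Subset using (Subset; _∈_; _∉_; _∪_; ⁅_⁆; inside; outside)
  renaming (⊥ to ∅)
open import Data.Vec using (Vec; []; _∷_; lookup)
open import Data.List using (List; []; _∷_; _++_; map; foldr; length; filter; [_]; allFin)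
open import Data.List.Membership.Propositional using () renaming (_∈_ to _∈ₗ_)
open import Data.List.Relation.Unary.Unique.Propositional using (Unique)
open import Data.List.Relation.Binary.Permutation.Propositional using (_↭_)
open import Data.Product using (Σ; ∃; _×_; _,_)
open import Data.Sum using (_⊎_)
open import Data.Empty using (⊥)
open import Data.Unit using (⊤)
open import Relation.Nullary using (¬_)
open import Relation.Binary.PropositionalEquality using (_≡_; _≢_)
open import Relation.Binary.Construct.Closure.ReflexiveTransitive using (Star)

-- Values (distances, times, dual variables).  The paper uses ℝ; since
-- the standard library has no reals we work over an arbitrary totally
-- ordered abelian group (ℝ is an instance).

record OrderedAbelianGroup : Set₁ where
  infixl 6 _+_ _-_
  infix 4 _≤_ _<_
  field
    Carrier     : Set
    _+_         : Carrier → Carrier → Carrier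
    0#          : Carrier
    -_          : Carrier → Carrier
    _≤_         : Carrier → Carrier → Set
    +-assoc     : ∀ a b c → (a + b) + c ≡ a + (b + c)
    +-comm      : ∀ a b → a + b ≡ b + a
    +-identityʳ : ∀ a → a + 0# ≡ a
    -‿inverseʳ  : ∀ a → a + (- a) ≡ 0#
    ≤-refl      : ∀ a → a ≤ a
    ≤-trans     : ∀ {a b c} → a ≤ b → b ≤ c → a ≤ c
    ≤-antisym   : ∀ {a b} → a ≤ b → b ≤ a → a ≡ b
    ≤-total     : ∀ a b → a ≤ b ⊎ b ≤ a
    +-monoʳ-≤   : ∀ c {a b} → a ≤ b → c + a ≤ c + b
    ∣_∣         : Carrier → Carrier
    ∣∣-nonneg   : ∀ a → 0# ≤ a → ∣ a ∣ ≡ a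
    ∣∣-nonpos   : ∀ a → a ≤ 0# → ∣ a ∣ ≡ - a

  _<_ : Carrier → Carrier → Set
  a < b = a ≤ b × a ≢ b

  _-_ : Carrier → Carrier → Carrier
  a - b = a + (- b)

  sumL : List Carrier → Carrier
  sumL = foldr _+_ 0#

record MetricSpace (G : OrderedAbelianGroup) : Set₁ where
  open OrderedAbelianGroup G
  field
    Point         : Set
    dist          : Point → Point → Carrier
    dist-nonneg   : ∀ x y → 0# ≤ dist x y
    dist-self     : ∀ x → dist x x ≡ 0#
    dist-zero     : ∀ x y → dist x y ≡ 0# → x ≡ y
    dist-sym      : ∀ x y → dist x y ≡ dist y x
    dist-triangle : ∀ x y z → dist x z ≤ dist x y + dist y z

data Sign : Set where
  minus zer plus : Sign

negate : Sign → Sign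
negate minus = plus
negate zer   = zer
negate plus  = minus

isPlus : Sign → Bool
isPlus plus = true
isPlus _    = false

isMinus : Sign → Bool
isMinus minus = true
isMinus _     = false

countTrue : ∀ {n} → (Fin n → Bool) → ℕ
countTrue {n} p = length (filter (λ u → p u Data.Bool.≟ true) (allFin n))

record Instance (G : OrderedAbelianGroup) (M : MetricSpace G) : Set where
  open OrderedAbelianGroup G
  open MetricSpace M
  field
    n     : ℕ
    pos   : Fin n → Point
    atime : Fin n → Carrier
    sgn   : Fin n → Sign

module _ {G : OrderedAbelianGroup} {M : MetricSpace G} (I : Instance G M) where
  open Instance I

  IsMPMD : Set
  IsMPMD = ∀ u → sgn u ≡ zer

  IsMBPMD : Set
  IsMBPMD = (∀ u → sgn u ≢ zer)
          × countTrue (λ u → isPlus (sgn u)) ≡ countTrue (λ u → isMinus (sgn u))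

  ValidInstance : Set
  ValidInstance = IsMPMD ⊎ IsMBPMD

IsWalk : ∀ {A : Set} → (A → A → Set) → List A → Set
IsWalk R []            = ⊤
IsWalk R (x ∷ [])      = ⊤
IsWalk R (x ∷ y ∷ xs)  = R x y × IsWalk R (y ∷ xs)

HasCycle : ∀ {A : Set} → (A → A → Set) → Set
HasCycle {A} R = Σ A λ v₀ → Σ A λ v₁ → Σ A λ v₂ → Σ (List A) λ rest →
  Unique (v₀ ∷ v₁ ∷ v₂ ∷ rest) × IsWalk R ((v₀ ∷ v₁ ∷ v₂ ∷ rest) ++ [ v₀ ])

module _ {n : ℕ} (S : Subset n) (Es : List (Fin n × Fin n)) where

  AdjIn : Fin n → Fin n → Set
  AdjIn u v = u ∈ S × v ∈ S × ((u , v) ∈ₗ Es ⊎ (v , u) ∈ₗ Es)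

  IsSpanningTreeOn : Set
  IsSpanningTreeOn =
      (∀ u → ¬ AdjIn u u)
    × (∀ u v → u ∈ S → v ∈ S → Star AdjIn u v)
    × ¬ HasCycle AdjIn

allSubsets : (m : ℕ) → List (Subset m)
allSubsets zero    = [] ∷ []
allSubsets (suc m) = map (outside ∷_) (allSubsets m) ++ map (inside ∷_) (allSubsets m)

module GD {G : OrderedAbelianGroup} {M : MetricSpace G} (I : Instance G M) where
  open OrderedAbelianGroup G
  open MetricSpace M
  open Instance I

  Req : Set
  Req = Fin n

  IsEdge : Req → Req → Set
  IsEdge u v = u ≢ v × sgn u ≡ negate (sgn v)

  optcost : Req → Req → Carrier
  optcost u v = dist (pos u) (pos v) + ∣ atime u - atime v ∣

  -- Σ_{S : {u,v} ∈ δ(S)} y_S   (sum over all subsets S of requests)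
  dualSum : (Subset n → Carrier) → Req → Req → Carrier
  dualSum y u v = sumL (map (λ S → if lookup S u xor lookup S v then y S else 0#)
                            (allSubsets n))

  record State : Set where
    field
      time     : Carrier
      arrived  : Subset n
      y        : Subset n → Carrier
      active   : List (Subset n)
      inactive : List (Subset n)
      marked   : List (Req × Req)
      matched  : List (Req × Req)

  open State public

  Matched : State → Req → Set
  Matched st u = ∃ λ v → (u , v) ∈ₗ matched st ⊎ (v , u) ∈ₗ matched st

  Free : State → Req → Set
  Free st u = u ∈ arrived st × ¬ Matched st u

  PendingMatch : State → Set
  PendingMatch st = Σ (Subset n) λ S → Σ Req λ u → Σ Req λ v →
    S ∈ₗ active st × u ∈ S × v ∈ S × IsEdge u v × Free st u × Free st v

  Growing : State → Subset n → Set
  Growing st S = S ∈ₗ active st × ∃ λ u → u ∈ S × Free st u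

  -- 𝒜(u) ≠ 𝒜(v), witnessed by a decomposition of the active partition
  DifferentActive : State → Req → Req → Subset n → Subset n → List (Subset n) → Set
  DifferentActive st u v S₁ S₂ rest =
    active st ↭ S₁ ∷ S₂ ∷ rest × u ∈ S₁ × v ∈ S₂

  TightCross : State → (Subset n → Carrier) → Req → Req → Set
  TightCross st y' u v =
    IsEdge u v
    × (Σ (Subset n) λ S₁ → Σ (Subset n) λ S₂ → Σ (List (Subset n)) λ rest →
         DifferentActive st u v S₁ S₂ rest)
    × dualSum y' u v ≡ optcost u v

  GrowsTo : State → Carrier → (Subset n → Carrier) → Set
  GrowsTo st d y' = ∀ S → (Growing st S → y' S ≡ y st S + d)
                        × (¬ Growing st S → y' S ≡ y st S)

  resetY : Req → (Subset n → Carrier) → Subset n → Carrier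
  resetY u y' S = if lookup S u then 0# else y' S

  data Step : State → State → Set where
    arrive : ∀ st u →
      ¬ PendingMatch st →
      u ∉ arrived st →
      atime u ≡ time st →
      Step st record st { arrived = arrived st ∪ ⁅ u ⁆
                        ; y       = resetY u (y st)
                        ; active  = ⁅ u ⁆ ∷ active st }
    merge : ∀ st u v S₁ S₂ rest →
      ¬ PendingMatch st →
      IsEdge u v →
      DifferentActive st u v S₁ S₂ rest →
      dualSum (y st) u v ≡ optcost u v →
      Step st record st { active   = (S₁ ∪ S₂) ∷ rest
                        ; inactive = S₁ ∷ S₂ ∷ inactive st
                        ; marked   = (u , v) ∷ marked st }
    match : ∀ st S u v →
      S ∈ₗ active st → u ∈ S → v ∈ S → IsEdge u v →
      Free st u → Free st v →
      Step st record st { matched = (u , v) ∷ matched st }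
    grow : ∀ st d y' →
      0# < d →
      ¬ PendingMatch st →
      (∀ u v → ¬ TightCross st (y st) u v) →
      (∀ d' y'' → 0# < d' → d' < d → GrowsTo st d' y'' →
         ∀ u v → ¬ TightCross st y'' u v) →
      (∀ u → u ∉ arrived st → time st + d ≤ atime u) →
      GrowsTo st d y' →
      Step st record st { time = time st + d ; y = y' }

  initial : Carrier → State
  initial t₀ = record
    { time = t₀ ; arrived = ∅ ; y = λ _ → 0#
    ; active = [] ; inactive = [] ; marked = [] ; matched = [] }

  Reachable : Carrier → State → Set
  Reachable t₀ = Star Step (initial t₀)

module Submission where

-- We maintain the
-- invariant that (i) active sets consist of arrived requests and are pairwise
-- disjoint, (ii) every marked edge joins two distinct requests of one active
-- set, (iii) the graph of all marked edges is acyclic, and (iv) every active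
-- or inactive set is connected by marked edges inside it.  Only arrivals and
-- merges change the relevant data.  An arrival adds a fresh singleton, which
-- is disjoint from the existing sets by (i).  A merge of S₁ ∋ u and S₂ ∋ v
-- adds the edge {u,v}; since by (ii) every old edge stays on one side of S₂,
-- this edge is a bridge, and a general lemma shows that adding a bridge to
-- an acyclic graph keeps it acyclic.

open import Defs
open import Data.Nat using (ℕ)
open import Data.Fin using (Fin)
open import Data.Sum using (_⊎_; inj₁; inj₂)
open import Data.Product using (Σ; _×_; _,_; proj₁; proj₂)
open import Data.Empty using (⊥-elim)
open import Data.Unit using (⊤; tt)
open import Data.Fin.Subset using (Subset; _∈_; _∉_; _⊆_; _∪_; ⁅_⁆)
open import Data.Fin.Subset.Properties using (x∈p∪q⁻; x∈p∪q⁺; x∈⁅y⁆⇒x≡y)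
open import Data.List using (List; []; _∷_; _++_; [_])
open import Data.List.Properties using (++-assoc; ++-identityʳ; ∷-injectiveˡ; ∷-injectiveʳ)
open import Data.List.Membership.Propositional using () renaming (_∈_ to _∈ₗ_)
open import Data.List.Relation.Unary.All as All using (All)
open import Data.List.Relation.Unary.Any using (here; there)
open import Data.List.Relation.Unary.AllPairs as AllPairs using (AllPairs; []; _∷_)
open import Data.List.Relation.Unary.Unique.Propositional using (Unique)
open import Data.List.Relation.Binary.Permutation.Propositional using (_↭_; ↭-sym; ↭⇒↭ₛ)
open import Data.List.Relation.Binary.Permutation.Propositional.Properties using (∈-resp-↭; ↭-length; ++-comm)
import Data.List.Relation.Binary.Permutation.Setoid.Properties as SetoidPermutation
open import Relation.Nullary using (¬_)
open import Relation.Binary.PropositionalEquality using (_≡_; _≢_; refl; sym; trans; cong; subst; setoid; resp₂)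
open import Relation.Binary.Construct.Closure.ReflexiveTransitive using (Star; ε; _◅_; _◅◅_) renaming (map to Star-map)

module Walks {A : Set} where

  open SetoidPermutation (setoid A) using (Unique-resp-↭)

  walk-map : ∀ {R R′ : A → A → Set} → (∀ {x y} → R x y → R′ x y) →
             ∀ W → IsWalk R W → IsWalk R′ W
  walk-map f []          _       = tt
  walk-map f (x ∷ [])    _       = tt
  walk-map f (x ∷ y ∷ W) (r , w) = f r , walk-map f (y ∷ W) w

  walk-snoc : ∀ {R : A → A → Set} W z w →
              IsWalk R (W ++ [ z ]) → R z w → IsWalk R ((W ++ [ z ]) ++ [ w ])
  walk-snoc []          z w _       r = r , tt
  walk-snoc (x ∷ [])    z w (r₁ , _) r = r₁ , r , tt
  walk-snoc (x ∷ y ∷ W) z w (r₁ , ws) r = r₁ , walk-snoc (y ∷ W) z w ws r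

  -- The closed walk visiting the vertices of C in order and returning to
  -- the first one.  HasCycle R asks for a Unique C of length ≥ 3 with
  -- ClosedWalk R C (definitionally).
  ClosedWalk : (A → A → Set) → List A → Set
  ClosedWalk R []      = ⊤
  ClosedWalk R (x ∷ C) = IsWalk R (x ∷ C ++ [ x ])

  rotate-one : ∀ {R} x C → ClosedWalk R (x ∷ C) → ClosedWalk R (C ++ [ x ])
  rotate-one x []      w       = w
  rotate-one x (y ∷ C) (r , w) = walk-snoc (y ∷ C) x y w r

  rotate : ∀ {R} xs ys → ClosedWalk R (xs ++ ys) → ClosedWalk R (ys ++ xs)
  rotate {R} []       ys w = subst (ClosedWalk R) (sym (++-identityʳ ys)) w
  rotate {R} (x ∷ xs) ys w =
    subst (ClosedWalk R) (++-assoc ys [ x ] xs)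
      (rotate xs (ys ++ [ x ])
        (subst (ClosedWalk R) (++-assoc xs ys [ x ]) (rotate-one x (xs ++ ys) w)))

  data StepIn (R : A → A → Set) (W : List A) : Set where
    step-at : ∀ xs a b ys → W ≡ xs ++ a ∷ b ∷ ys → R a b → StepIn R W

  walk-or-step : ∀ {R R₁ R₂ : A → A → Set} → (∀ {x y} → R x y → R₁ x y ⊎ R₂ x y) →
                 ∀ W → IsWalk R W → IsWalk R₁ W ⊎ StepIn R₂ W
  walk-or-step split []          _       = inj₁ tt
  walk-or-step split (x ∷ [])    _       = inj₁ tt
  walk-or-step split (x ∷ y ∷ W) (r , w) with split r | walk-or-step split (y ∷ W) w
  ... | inj₂ r₂ | _      = inj₂ (step-at [] x y W refl r₂)
  ... | inj₁ r₁ | inj₁ w₁ = inj₁ (r₁ , w₁)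
  ... | inj₁ r₁ | inj₂ (step-at xs a b ys eq r₂) =
    inj₂ (step-at (x ∷ xs) a b ys (cong (x ∷_) eq) r₂)

  split-snoc : ∀ W (z : A) xs a b ys → W ++ [ z ] ≡ xs ++ a ∷ b ∷ ys →
               Σ (List A) λ zs → W ≡ xs ++ a ∷ zs × zs ++ [ z ] ≡ b ∷ ys
  split-snoc []      z []           a b ys ()
  split-snoc []      z (x ∷ [])     a b ys ()
  split-snoc []      z (x ∷ y ∷ xs) a b ys ()
  split-snoc (w ∷ W) z []           a b ys eq =
    W , cong (_∷ W) (∷-injectiveˡ eq) , ∷-injectiveʳ eq
  split-snoc (w ∷ W) z (x ∷ xs)     a b ys eq with split-snoc W z xs a b ys (∷-injectiveʳ eq)
  ... | zs , W≡ , zs≡ = zs , trans (cong (_∷ W) (∷-injectiveˡ eq)) (cong (x ∷_) W≡) , zs≡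

  RotatedToStep : (R R₂ : A → A → Set) → List A → Set
  RotatedToStep R R₂ C = Σ A λ a → Σ A λ b → Σ (List A) λ D →
    R₂ a b × C ↭ (a ∷ b ∷ D) × ClosedWalk R (a ∷ b ∷ D)

  rotate-to-step : ∀ {R R₂ : A → A → Set} x y C → ClosedWalk R (x ∷ y ∷ C) →
                   StepIn R₂ (x ∷ y ∷ C ++ [ x ]) → RotatedToStep R R₂ (x ∷ y ∷ C)
  rotate-to-step {R} {R₂} x y C w (step-at xs a b ys eq r₂)
    with split-snoc (x ∷ y ∷ C) x xs a b ys eq
  ... | zs , C≡ , zs≡ = front zs xs C≡ zs≡ perm rotated
    where
    perm : (x ∷ y ∷ C) ↭ (a ∷ zs) ++ xs
    perm = subst (_↭ (a ∷ zs) ++ xs) (sym C≡) (++-comm xs (a ∷ zs))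

    rotated : ClosedWalk R ((a ∷ zs) ++ xs)
    rotated = rotate xs (a ∷ zs) (subst (ClosedWalk R) C≡ w)

    front : ∀ zs xs → x ∷ y ∷ C ≡ xs ++ a ∷ zs → zs ++ [ x ] ≡ b ∷ ys →
            (x ∷ y ∷ C) ↭ (a ∷ zs) ++ xs → ClosedWalk R ((a ∷ zs) ++ xs) →
            RotatedToStep R R₂ (x ∷ y ∷ C)
    front (z ∷ zs) xs _ zs≡ p c with ∷-injectiveˡ zs≡
    ... | refl = a , z , zs ++ xs , r₂ , p , c
    front [] [] C≡ _ _ _ with ∷-injectiveʳ C≡
    ... | ()
    front [] (x′ ∷ xs) C≡ zs≡ p c with ∷-injectiveˡ C≡ | ∷-injectiveˡ zs≡
    ... | refl | refl = a , x′ , xs , r₂ , p , c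

  unique-resp-↭ : ∀ {C D : List A} → C ↭ D → Unique C → Unique D
  unique-resp-↭ p = Unique-resp-↭ (↭⇒↭ₛ p)

open Walks

Joins : {A : Set} → A → A → A → A → Set
Joins u v x y = (x ≡ u × y ≡ v) ⊎ (x ≡ v × y ≡ u)

-- New consists of Old plus the edge {u, v}; all Old-steps preserve the
-- predicate P, while P separates u from v.  Then {u,v} is a bridge and
-- New is acyclic whenever Old is.
module Bridge {A : Set} (Old New : A → A → Set) (u v : A) (P : A → Set)
  (old-or-uv : ∀ {x y} → New x y → Old x y ⊎ Joins u v x y)
  (old-keeps-P : ∀ {x y} → Old x y → (P x → P y) × (P y → P x))
  (¬Pu : ¬ P u) (Pv : P v) where

  SameSide : A → A → Set
  SameSide x y = (P x → P y) × (P y → P x)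

  same-side-trans : ∀ {x y z} → SameSide x y → SameSide y z → SameSide x z
  same-side-trans (f , g) (h , k) = (λ p → h (f p)) , (λ p → g (k p))

  Off : A → Set
  Off z = u ≢ z × v ≢ z

  -- A New-step with an endpoint off {u, v} is an Old-step, so it keeps the side.
  keeps-side-from : ∀ {x y} → Off x → New x y → SameSide x y
  keeps-side-from off r with old-or-uv r
  ... | inj₁ o                = old-keeps-P o
  ... | inj₂ (inj₁ (refl , _)) = ⊥-elim (proj₁ off refl)
  ... | inj₂ (inj₂ (refl , _)) = ⊥-elim (proj₂ off refl)

  keeps-side-into : ∀ {x y} → Off y → New x y → SameSide x y
  keeps-side-into off r with old-or-uv r
  ... | inj₁ o                = old-keeps-P o
  ... | inj₂ (inj₁ (_ , refl)) = ⊥-elim (proj₂ off refl)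
  ... | inj₂ (inj₂ (_ , refl)) = ⊥-elim (proj₁ off refl)

  crossing-keeps-side : ∀ x m I y → IsWalk New (x ∷ m ∷ I ++ [ y ]) →
                        All Off (m ∷ I) → SameSide x y
  crossing-keeps-side x m []       y (r₁ , r₂ , _) (off All.∷ _) =
    same-side-trans (keeps-side-into off r₁) (keeps-side-from off r₂)
  crossing-keeps-side x m (m′ ∷ I) y (r₁ , w) (off All.∷ offs) =
    same-side-trans (keeps-side-into off r₁) (crossing-keeps-side m m′ I y w offs)

  -- A cycle beginning with the edge {u, v} returns along a path avoiding
  -- u and v, which would connect the two sides of P.
  no-cycle-through-uv : ∀ a b m M → Joins u v a b → Unique (a ∷ b ∷ m ∷ M) →
                        ¬ ClosedWalk New (a ∷ b ∷ m ∷ M)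
  no-cycle-through-uv a b m M (inj₁ (refl , refl)) ((_ All.∷ u∉) ∷ (v∉ ∷ _)) (_ , w) =
    ¬Pu (proj₁ (crossing-keeps-side v m M u w (All.zip (u∉ , v∉))) Pv)
  no-cycle-through-uv a b m M (inj₂ (refl , refl)) ((_ All.∷ v∉) ∷ (u∉ ∷ _)) (_ , w) =
    ¬Pu (proj₂ (crossing-keeps-side u m M v w (All.zip (u∉ , v∉))) Pv)

  bridge-acyclic : ¬ HasCycle Old → ¬ HasCycle New
  bridge-acyclic old-acyclic (v₀ , v₁ , v₂ , rest , uniq , w)
    with walk-or-step old-or-uv (v₀ ∷ v₁ ∷ v₂ ∷ rest ++ [ v₀ ]) w
  ... | inj₁ old-walk = old-acyclic (v₀ , v₁ , v₂ , rest , uniq , old-walk)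
  ... | inj₂ uv-step  = through-uv (rotate-to-step v₀ v₁ (v₂ ∷ rest) w uv-step)
    where
    through-uv : ¬ RotatedToStep New (Joins u v) (v₀ ∷ v₁ ∷ v₂ ∷ rest)
    through-uv (a , b , [] , _ , p , _) with ↭-length p
    ... | ()
    through-uv (a , b , m ∷ M , j , p , c) =
      no-cycle-through-uv a b m M j (unique-resp-↭ p uniq) c

module _ {n : ℕ} where

  Disjoint : Subset n → Subset n → Set
  Disjoint A B = ∀ {x} → x ∈ A → x ∉ B

  disjoint-sym : ∀ {A B : Subset n} → Disjoint A B → Disjoint B A
  disjoint-sym d x∈B x∈A = d x∈A x∈B

  disjoint-∪ : ∀ {A₁ A₂ B : Subset n} → Disjoint A₁ B → Disjoint A₂ B → Disjoint (A₁ ∪ A₂) B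
  disjoint-∪ {A₁} {A₂} d₁ d₂ x∈ with x∈p∪q⁻ A₁ A₂ x∈
  ... | inj₁ x₁ = d₁ x₁
  ... | inj₂ x₂ = d₂ x₂

  Adj : List (Fin n × Fin n) → Fin n → Fin n → Set
  Adj Es p q = (p , q) ∈ₗ Es ⊎ (q , p) ∈ₗ Es

  Connected : Subset n → List (Fin n × Fin n) → Set
  Connected S Es = ∀ p q → p ∈ S → q ∈ S → Star (AdjIn S Es) p q

  path-mono : ∀ {S S′ : Subset n} {Es Es′ : List (Fin n × Fin n)} →
              S ⊆ S′ → (∀ {e} → e ∈ₗ Es → e ∈ₗ Es′) → ∀ {p q} → Star (AdjIn S Es) p q → Star (AdjIn S′ Es′) p q
  path-mono S⊆ Es⊆ = Star-map λ where
    (p∈ , q∈ , inj₁ e) → S⊆ p∈ , S⊆ q∈ , inj₁ (Es⊆ e)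
    (p∈ , q∈ , inj₂ e) → S⊆ p∈ , S⊆ q∈ , inj₂ (Es⊆ e)

  connected-singleton : ∀ {Es} u → Connected ⁅ u ⁆ Es
  connected-singleton u p q p∈ q∈ =
    subst (Star _ p) (trans (x∈⁅y⁆⇒x≡y u p∈) (sym (x∈⁅y⁆⇒x≡y u q∈))) ε

  connected-extend : ∀ {S : Subset n} {Es} e → Connected S Es → Connected S (e ∷ Es)
  connected-extend e c p q p∈ q∈ = path-mono (λ x∈ → x∈) there (c p q p∈ q∈)

  module Union {S₁ S₂ : Subset n} {Es : List (Fin n × Fin n)} {u v : Fin n}
               (u∈ : u ∈ S₁) (v∈ : v ∈ S₂) where

    Path : Fin n → Fin n → Set
    Path = Star (AdjIn (S₁ ∪ S₂) ((u , v) ∷ Es))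

    from₁ : ∀ {p q} → Star (AdjIn S₁ Es) p q → Path p q
    from₁ = path-mono (λ x∈ → x∈p∪q⁺ (inj₁ x∈)) there

    from₂ : ∀ {p q} → Star (AdjIn S₂ Es) p q → Path p q
    from₂ = path-mono (λ x∈ → x∈p∪q⁺ (inj₂ x∈)) there

    uv : Path u v
    uv = (x∈p∪q⁺ (inj₁ u∈) , x∈p∪q⁺ (inj₂ v∈) , inj₁ (here refl)) ◅ ε

    vu : Path v u
    vu = (x∈p∪q⁺ (inj₂ v∈) , x∈p∪q⁺ (inj₁ u∈) , inj₂ (here refl)) ◅ ε

  connected-union : ∀ {S₁ S₂ : Subset n} {Es u v} → u ∈ S₁ → v ∈ S₂ →
                    Connected S₁ Es → Connected S₂ Es →
                    Connected (S₁ ∪ S₂) ((u , v) ∷ Es)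
  connected-union {S₁} {S₂} {Es} {u} {v} u∈ v∈ c₁ c₂ p q p∈ q∈ =
    join (x∈p∪q⁻ S₁ S₂ p∈) (x∈p∪q⁻ S₁ S₂ q∈)
    where
    open Union u∈ v∈
    join : p ∈ S₁ ⊎ p ∈ S₂ → q ∈ S₁ ⊎ q ∈ S₂ → Path p q
    join (inj₁ p₁) (inj₁ q₁) = from₁ (c₁ p q p₁ q₁)
    join (inj₁ p₁) (inj₂ q₂) = from₁ (c₁ p u p₁ u∈) ◅◅ uv ◅◅ from₂ (c₂ v q v∈ q₂)
    join (inj₂ p₂) (inj₁ q₁) = from₂ (c₂ p v p₂ v∈) ◅◅ vu ◅◅ from₁ (c₁ u q u∈ q₁)
    join (inj₂ p₂) (inj₂ q₂) = from₂ (c₂ p q p₂ q₂)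

module Invariant {G : OrderedAbelianGroup} {M : MetricSpace G} (I : Instance G M) where
  open GD I
  open Instance I using (n)
  open SetoidPermutation (setoid (Subset n)) using (AllPairs-resp-↭)

  InOneSet : List (Subset n) → Req → Req → Set
  InOneSet As p q = Σ (Subset n) λ A → A ∈ₗ As × p ∈ A × q ∈ A

  record GDInvariant (st : State) : Set where
    field
      active-arrived  : ∀ {A} → A ∈ₗ active st → A ⊆ arrived st
      active-disjoint : AllPairs Disjoint (active st)
      marked-inside   : ∀ {p q} → (p , q) ∈ₗ marked st → p ≢ q × InOneSet (active st) p q
      marked-acyclic  : ¬ HasCycle (Adj (marked st))
      sets-connected  : ∀ {S} → S ∈ₗ active st ⊎ S ∈ₗ inactive st → Connected S (marked st)

  invariant-initial : ∀ t₀ → GDInvariant (initial t₀)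
  invariant-initial t₀ = record
    { active-arrived  = λ ()
    ; active-disjoint = []
    ; marked-inside   = λ ()
    ; marked-acyclic  = λ { (_ , _ , _ , _ , _ , inj₁ () , _) ; (_ , _ , _ , _ , _ , inj₂ () , _) }
    ; sets-connected  = λ { (inj₁ ()) ; (inj₂ ()) } }

  -- A newly arrived request u forms a singleton active set, disjoint from
  -- all others since they consist of arrived requests.
  invariant-arrive : ∀ {st} u → u ∉ arrived st → GDInvariant st →
    GDInvariant (record st { arrived = arrived st ∪ ⁅ u ⁆
                           ; y       = resetY u (y st)
                           ; active  = ⁅ u ⁆ ∷ active st })
  invariant-arrive {st} u u∉ inv = record
    { active-arrived  = λ where
        (here refl) x∈  → x∈p∪q⁺ (inj₂ x∈)
        (there A∈)  x∈  → x∈p∪q⁺ (inj₁ (active-arrived A∈ x∈))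
    ; active-disjoint = All.tabulate fresh ∷ active-disjoint
    ; marked-inside   = λ e∈ → let (p≢q , A , A∈ , p∈ , q∈) = marked-inside e∈
                               in p≢q , A , there A∈ , p∈ , q∈
    ; marked-acyclic  = marked-acyclic
    ; sets-connected  = λ where
        (inj₁ (here refl)) → connected-singleton u
        (inj₁ (there A∈))  → sets-connected (inj₁ A∈)
        (inj₂ A∈)          → sets-connected (inj₂ A∈) }
    where
    open GDInvariant inv
    fresh : ∀ {A} → A ∈ₗ active st → Disjoint ⁅ u ⁆ A
    fresh A∈ x∈⁅u⁆ x∈A =
      u∉ (subst (_∈ arrived st) (x∈⁅y⁆⇒x≡y u x∈⁅u⁆) (active-arrived A∈ x∈A))

  module Merge {st : State} {u v : Req} {S₁ S₂ : Subset n} {rest : List (Subset n)}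
               (inv : GDInvariant st) (edge : IsEdge u v)
               (perm : active st ↭ S₁ ∷ S₂ ∷ rest) (u∈ : u ∈ S₁) (v∈ : v ∈ S₂) where
    open GDInvariant inv

    merged : State
    merged = record st { active   = (S₁ ∪ S₂) ∷ rest
                       ; inactive = S₁ ∷ S₂ ∷ inactive st
                       ; marked   = (u , v) ∷ marked st }

    to-old : ∀ {A} → A ∈ₗ S₁ ∷ S₂ ∷ rest → A ∈ₗ active st
    to-old = ∈-resp-↭ (↭-sym perm)

    from-old : ∀ {A} → A ∈ₗ active st → A ∈ₗ S₁ ∷ S₂ ∷ rest
    from-old = ∈-resp-↭ perm

    disjoint : AllPairs Disjoint (S₁ ∷ S₂ ∷ rest)
    disjoint = AllPairs-resp-↭ disjoint-sym (resp₂ Disjoint) (↭⇒↭ₛ perm) active-disjoint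

    S₁-S₂ : Disjoint S₁ S₂
    S₁-S₂ = All.head (AllPairs.head disjoint)

    S₁-rest : All (Disjoint S₁) rest
    S₁-rest = All.tail (AllPairs.head disjoint)

    S₂-rest : All (Disjoint S₂) rest
    S₂-rest = AllPairs.head (AllPairs.tail disjoint)

    S₁∪S₂-rest : All (Disjoint (S₁ ∪ S₂)) rest
    S₁∪S₂-rest = All.tabulate λ A∈ → disjoint-∪ (All.lookup S₁-rest A∈) (All.lookup S₂-rest A∈)

    -- Each old active set lies within one side of S₂ ...
    side : ∀ {A x y} → A ∈ₗ S₁ ∷ S₂ ∷ rest → x ∈ A → y ∈ A → x ∈ S₂ → y ∈ S₂
    side (here refl)         x∈ _  x₂ = ⊥-elim (S₁-S₂ x∈ x₂)
    side (there (here refl)) _  y∈ _  = y∈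
    side (there (there A∈))  x∈ _  x₂ = ⊥-elim (All.lookup S₂-rest A∈ x₂ x∈)

    -- ... hence so does every old marked edge, which makes {u,v} a bridge.
    old-keeps-side : ∀ {p q} → Adj (marked st) p q → (p ∈ S₂ → q ∈ S₂) × (q ∈ S₂ → p ∈ S₂)
    old-keeps-side (inj₁ e∈) with marked-inside e∈
    ... | _ , A , A∈ , p∈ , q∈ = side (from-old A∈) p∈ q∈ , side (from-old A∈) q∈ p∈
    old-keeps-side (inj₂ e∈) with marked-inside e∈
    ... | _ , A , A∈ , q∈ , p∈ = side (from-old A∈) p∈ q∈ , side (from-old A∈) q∈ p∈

    old-or-uv : ∀ {p q} → Adj ((u , v) ∷ marked st) p q → Adj (marked st) p q ⊎ Joins u v p q
    old-or-uv (inj₁ (here refl)) = inj₂ (inj₁ (refl , refl))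
    old-or-uv (inj₁ (there e∈))  = inj₁ (inj₁ e∈)
    old-or-uv (inj₂ (here refl)) = inj₂ (inj₂ (refl , refl))
    old-or-uv (inj₂ (there e∈))  = inj₁ (inj₂ e∈)

    coarsen : ∀ {A} → A ∈ₗ S₁ ∷ S₂ ∷ rest → Σ (Subset n) λ B → B ∈ₗ (S₁ ∪ S₂) ∷ rest × A ⊆ B
    coarsen (here refl)         = S₁ ∪ S₂ , here refl , λ x∈ → x∈p∪q⁺ (inj₁ x∈)
    coarsen (there (here refl)) = S₁ ∪ S₂ , here refl , λ x∈ → x∈p∪q⁺ (inj₂ x∈)
    coarsen (there (there A∈))  = _ , there A∈ , λ x∈ → x∈

    inside-merged : ∀ {p q} → InOneSet (active st) p q → InOneSet ((S₁ ∪ S₂) ∷ rest) p q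
    inside-merged (A , A∈ , p∈ , q∈) with coarsen (from-old A∈)
    ... | B , B∈ , A⊆B = B , B∈ , A⊆B p∈ , A⊆B q∈

    marked-inside′ : ∀ {p q} → (p , q) ∈ₗ (u , v) ∷ marked st →
                     p ≢ q × InOneSet ((S₁ ∪ S₂) ∷ rest) p q
    marked-inside′ (here refl) = proj₁ edge , S₁ ∪ S₂ , here refl , x∈p∪q⁺ (inj₁ u∈) , x∈p∪q⁺ (inj₂ v∈)
    marked-inside′ (there e∈) with marked-inside e∈
    ... | p≢q , inside = p≢q , inside-merged inside

    active-arrived′ : ∀ {A} → A ∈ₗ (S₁ ∪ S₂) ∷ rest → A ⊆ arrived st
    active-arrived′ (here refl) x∈ with x∈p∪q⁻ S₁ S₂ x∈
    ... | inj₁ x₁ = active-arrived (to-old (here refl)) x₁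
    ... | inj₂ x₂ = active-arrived (to-old (there (here refl))) x₂
    active-arrived′ (there A∈) = active-arrived (to-old (there (there A∈)))

    sets-connected′ : ∀ {S} → S ∈ₗ (S₁ ∪ S₂) ∷ rest ⊎ S ∈ₗ S₁ ∷ S₂ ∷ inactive st →
                      Connected S ((u , v) ∷ marked st)
    sets-connected′ (inj₁ (here refl)) =
      connected-union u∈ v∈ (sets-connected (inj₁ (to-old (here refl))))
                            (sets-connected (inj₁ (to-old (there (here refl)))))
    sets-connected′ (inj₁ (there A∈)) =
      connected-extend _ (sets-connected (inj₁ (to-old (there (there A∈)))))
    sets-connected′ (inj₂ (here refl)) =
      connected-extend _ (sets-connected (inj₁ (to-old (here refl))))
    sets-connected′ (inj₂ (there (here refl))) =
      connected-extend _ (sets-connected (inj₁ (to-old (there (here refl)))))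
    sets-connected′ (inj₂ (there (there A∈))) =
      connected-extend _ (sets-connected (inj₂ A∈))

    invariant : GDInvariant merged
    invariant = record
      { active-arrived  = active-arrived′
      ; active-disjoint = S₁∪S₂-rest ∷ AllPairs.tail (AllPairs.tail disjoint)
      ; marked-inside   = marked-inside′
      ; marked-acyclic  = Bridge.bridge-acyclic (Adj (marked st)) (Adj ((u , v) ∷ marked st))
                            u v (_∈ S₂) old-or-uv old-keeps-side (S₁-S₂ u∈) v∈ marked-acyclic
      ; sets-connected  = sets-connected′ }

  -- Every step preserves the invariant; matching requests and growing dual
  -- variables leave all the data it mentions unchanged.
  step-invariant : ∀ {st st′} → GDInvariant st → Step st st′ → GDInvariant st′
  step-invariant inv (arrive st u _ u∉ _) = invariant-arrive u u∉ inv
  step-invariant inv (merge st u v S₁ S₂ rest _ edge (perm , u∈ , v∈) _) =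
    Merge.invariant inv edge perm u∈ v∈
  step-invariant inv (match _ _ _ _ _ _ _ _ _ _) = record { GDInvariant inv }
  step-invariant inv (grow _ _ _ _ _ _ _ _ _)    = record { GDInvariant inv }

  reachable-invariant : ∀ {t₀ st} → Reachable t₀ st → GDInvariant st
  reachable-invariant {t₀} = go (invariant-initial t₀)
    where
    go : ∀ {st st′} → GDInvariant st → Star Step st st′ → GDInvariant st′
    go inv ε          = inv
    go inv (s ◅ steps) = go (step-invariant inv s) steps

  spanning-tree : ∀ {st} → GDInvariant st → ∀ {S} → S ∈ₗ active st ⊎ S ∈ₗ inactive st →
                  IsSpanningTreeOn S (marked st)
  spanning-tree {st} inv {S} S∈ = no-loop , sets-connected S∈ , no-cycle
    where
    open GDInvariant inv
    no-loop : ∀ p → ¬ AdjIn S (marked st) p p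
    no-loop p (_ , _ , inj₁ e∈) = proj₁ (marked-inside e∈) refl
    no-loop p (_ , _ , inj₂ e∈) = proj₁ (marked-inside e∈) refl
    -- a cycle inside S is a cycle of the whole marked graph
    no-cycle : ¬ HasCycle (AdjIn S (marked st))
    no-cycle (v₀ , v₁ , v₂ , rest , uniq , w) =
      marked-acyclic (v₀ , v₁ , v₂ , rest , uniq , walk-map (λ adj → proj₂ (proj₂ adj)) _ w)

-- Lemma 6.  The invariant holds along every run.

lemma6 : (G : OrderedAbelianGroup) (M : MetricSpace G) (I : Instance G M) →
         ValidInstance I →
         (t₀ : OrderedAbelianGroup.Carrier G) →
         (∀ u → OrderedAbelianGroup._≤_ G t₀ (Instance.atime I u)) →
         (st : GD.State I) → GD.Reachable I t₀ st →
         (S : Subset (Instance.n I)) →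
         (S ∈ₗ GD.State.active st ⊎ S ∈ₗ GD.State.inactive st) →
         IsSpanningTreeOn S (GD.State.marked st)
lemma6 G M I _ t₀ _ st reachable S S∈ = spanning-tree (reachable-invariant reachable) S∈
  where open Invariant I
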